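{- If $n\ge 2$ and $m\ge 4$, then $\operatorname{Dist}_f(B_{m,n})=2+\left\lfloor \frac{n-1}{m-2}\right\rfloor$.
   Context: The book graph $B_{m,n}$ consists of $n$ copies of the cycle $C_m$ identified along a single common edge. A $d$-distinguishing coloring of a graph $G$ is an assignment of colors from a set of $d$ colors to the vertices such that the only automorphism mapping each color class to itself is the identity. The paint cost $\rho^d(G)$ is the minimum of $|V(G)\setminus T|$ over all $d$-distinguishing colorings of $G$ and all their color classes $T$. A determining set is a set $S\subseteq V(G)$ such that only the identity automorphism fixes every vertex of $S$; $\det(G)$ is its minimum size. The frugal distinguishing number $\operatorname{Dist}_f(G)$ is the smallest $d$ for which $\rho^d(G)=\det(G)$. -}

module Defs where

open import Data.Nat using (ℕ; zero; suc; _+_; _∸_; _≤_; _<_; s≤s; NonZero)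
open import Data.Fin using (Fin; toℕ) renaming (_≟_ to _≟ᶠ_)
open import Data.Bool using (Bool; true) renaming (_≟_ to _≟ᵇ_)
open import Data.List using (List; []; _∷_; map; concatMap; filter; length; allFin)
open import Data.Product using (Σ; _×_; _,_; ∃)
open import Data.Sum using (_⊎_)
open import Relation.Binary.PropositionalEquality using (_≡_)
open import Relation.Nullary using (¬_; ¬?)

-- The book graph B_{m,n}: n copies of C_m sharing the edge {left,right}.
-- Vertex type BV n k with k = m - 2: each copy i contributes the k inner
-- vertices inner i 0, ..., inner i (k-1), forming the cycle
-- left - inner i 0 - ... - inner i (k-1) - right - left.

data BV (n k : ℕ) : Set where
  left  : BV n k
  right : BV n k
  inner : Fin n → Fin k → BV n k

data Edge {n k : ℕ} : BV n k → BV n k → Set where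
  e-lr    : Edge left right
  e-left  : ∀ i j → toℕ j ≡ 0 → Edge left (inner i j)
  e-step  : ∀ i j j′ → toℕ j′ ≡ suc (toℕ j) → Edge (inner i j) (inner i j′)
  e-right : ∀ i j → suc (toℕ j) ≡ k → Edge (inner i j) right

Adj : ∀ {n k} → BV n k → BV n k → Set
Adj x y = Edge x y ⊎ Edge y x

allV : (n k : ℕ) → List (BV n k)
allV n k = left ∷ right ∷ concatMap (λ i → map (inner i) (allFin k)) (allFin n)

Book : ℕ → ℕ → Set
Book m n = BV n (m ∸ 2)

record Aut (m n : ℕ) : Set where
  field
    fun   : Book m n → Book m n
    inv   : Book m n → Book m n
    inv-l : ∀ x → inv (fun x) ≡ x
    inv-r : ∀ x → fun (inv x) ≡ x
    adj→  : ∀ x y → Adj x y → Adj (fun x) (fun y)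
    adj←  : ∀ x y → Adj (fun x) (fun y) → Adj x y
open Aut public

IsIdentity : ∀ {m n} → Aut m n → Set
IsIdentity σ = ∀ x → fun σ x ≡ x

Coloring : ℕ → ℕ → ℕ → Set
Coloring m n d = Book m n → Fin d

Distinguishing : ∀ m n {d} → Coloring m n d → Set
Distinguishing m n c = (σ : Aut m n) → (∀ x → c (fun σ x) ≡ c x) → IsIdentity σ

outsideClass : ∀ m n {d} → Coloring m n d → Fin d → ℕ
outsideClass m n c t = length (filter (λ x → ¬? (c x ≟ᶠ t)) (allV n (m ∸ 2)))

-- ρ^d(B_{m,n}) = r  (the minimum exists and equals r; in particular some
-- d-distinguishing coloring exists)
PaintCost : ℕ → ℕ → ℕ → ℕ → Set
PaintCost m n d r =
  (Σ (Coloring m n d) λ c → Distinguishing m n c × Σ (Fin d) λ t → outsideClass m n c t ≡ r)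
  × ((c : Coloring m n d) → Distinguishing m n c → (t : Fin d) → r ≤ outsideClass m n c t)

VSubset : ℕ → ℕ → Set
VSubset m n = Book m n → Bool

size : ∀ m n → VSubset m n → ℕ
size m n S = length (filter (λ x → S x ≟ᵇ true) (allV n (m ∸ 2)))

Determining : ∀ m n → VSubset m n → Set
Determining m n S = (σ : Aut m n) → (∀ x → S x ≡ true → fun σ x ≡ x) → IsIdentity σ

Det : ℕ → ℕ → ℕ → Set
Det m n k =
  (Σ (VSubset m n) λ S → Determining m n S × size m n S ≡ k)
  × ((S : VSubset m n) → Determining m n S → k ≤ size m n S)

RhoEqDet : ℕ → ℕ → ℕ → Set
RhoEqDet m n d = Σ ℕ λ r → PaintCost m n d r × Det m n r

DistF : ℕ → ℕ → ℕ → Set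
DistF m n D = RhoEqDet m n D × (∀ d → d < D → ¬ RhoEqDet m n d)

-- m ≥ 4 makes m - 2 nonzero, so (n - 1) / (m - 2) is defined
m∸2-nonZero : ∀ {m} → 4 ≤ m → NonZero (m ∸ 2)
m∸2-nonZero (s≤s (s≤s (s≤s (s≤s _)))) = record {}

module Submission where

-- Two pages that a set of vertices misses entirely can be swapped, so a determining set
-- meets all pages but one and det B_{m,n} = n − 1; the complement of a colour class of a
-- distinguishing colouring is determining, so ρ^d ≥ det.  If a class t has complement of
-- size exactly n − 1, then both spine vertices have colour t and every page reads a word
-- with at most one letter other than t; there are 1 + (m−2)(d−1) such words, and distinct
-- pages need distinct words.  When there are at least that many pages every word occurs,
-- the set of words is closed under reversal, and reflecting the book across its spine
-- preserves the colouring.  So (m−2)(d−1) ≥ n, that is d ≥ 2 + ⌊(n−1)/(m−2)⌋.  With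
-- that many colours, marking page z ≥ 1 by a single letter encoding z, placed so that the
-- first colour occurs next to one spine vertex but not the other, is distinguishing.

open import Defs
open import Data.Nat using (ℕ; zero; suc; _+_; _*_; _∸_; _≤_; _<_; s≤s; z≤n; s≤s⁻¹)
open import Data.Nat.Properties
open import Data.Nat.DivMod using (_/_; _%_; m≡m%n+[m/n]*n; m%n<n)
open import Data.Nat.Tactic.RingSolver using (solve-∀)
open import Algebra.Properties.CommutativeSemigroup +-commutativeSemigroup using (x∙yz≈y∙xz)
open import Algebra.Properties.CommutativeMonoid.Sum +-0-commutativeMonoid
  using (sum; sum-syntax; sum-cong-≗; sum-remove; sum-replicate-zero)
open import Data.Fin
  using (Fin; zero; suc; toℕ; fromℕ; fromℕ<; opposite; punchIn; punchOut; combine; remQuot; inject≤)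
  renaming (_≟_ to _≟ᶠ_)
open import Data.Fin.Properties
  using ( toℕ-injective; toℕ<n; toℕ-fromℕ; toℕ-fromℕ<; opposite-prop; opposite-involutive
        ; punchIn-injective; punchInᵢ≢i; punchOut-injective; punchIn-punchOut; any?
        ; injective⇒≤; combine-injective; combine-remQuot; inject≤-injective )
  renaming (suc-injective to suc-injectiveᶠ)
open import Data.Fin.Permutation using (Permutation′; permutation; transpose; _⟨$⟩ʳ_; _⟨$⟩ˡ_; inverseˡ; inverseʳ)
import Data.Fin.Permutation.Components as Components
open import Data.Bool using (true) renaming (_≟_ to _≟ᵇ_)
open import Data.List using (List; _∷_; _++_; map; concatMap; filter; length; tabulate; allFin)
open import Data.List.Properties using (filter-++; length-++; map-tabulate; filter-≐)
open import Data.Product using (∃; ∃₂; _×_; _,_; proj₁; proj₂)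
open import Data.Sum using (_⊎_; inj₁; inj₂) renaming (swap to ⊎-swap; map to ⊎-map)
open import Data.Empty using (⊥)
open import Function using (_∘_; id; Injective)
open import Relation.Nullary using (¬_; Dec; yes; no; ¬?; contradiction; does)
open import Relation.Nullary.Decidable using (dec-true; dec-false; decidable-stable)
open import Relation.Unary using (Decidable)
open import Relation.Binary.PropositionalEquality

𝟙 : {P : Set} → Dec P → ℕ
𝟙 (yes _) = 1
𝟙 (no _)  = 0

𝟙-yes : {P : Set} (P? : Dec P) → P → 𝟙 P? ≡ 1
𝟙-yes (yes _) _  = refl
𝟙-yes (no ¬p) p = contradiction p ¬p

𝟙-no : {P : Set} (P? : Dec P) → ¬ P → 𝟙 P? ≡ 0
𝟙-no (yes p) ¬p = contradiction p ¬p
𝟙-no (no _)  _  = refl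

𝟙≡0⇒¬ : {P : Set} (P? : Dec P) → 𝟙 P? ≡ 0 → ¬ P
𝟙≡0⇒¬ (no ¬p) _ = ¬p

sum-zero : ∀ {n} {f : Fin n → ℕ} → (∀ i → f i ≡ 0) → sum f ≡ 0
sum-zero {n} f≡0 = trans (sum-cong-≗ f≡0) (sum-replicate-zero n)

sum≡0⇒zero : ∀ {n} (f : Fin n → ℕ) → sum f ≡ 0 → ∀ i → f i ≡ 0
sum≡0⇒zero f Σf≡0 zero    = m+n≡0⇒m≡0 (f zero) Σf≡0
sum≡0⇒zero f Σf≡0 (suc i) = sum≡0⇒zero (f ∘ suc) (m+n≡0⇒n≡0 (f zero) Σf≡0) i

≤sum : ∀ {n} (f : Fin n → ℕ) i → f i ≤ sum f
≤sum f zero    = m≤m+n (f zero) _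
≤sum f (suc i) = ≤-trans (≤sum (f ∘ suc) i) (m≤n+m _ (f zero))

+≤sum : ∀ {n} (f : Fin n → ℕ) {i j} → i ≢ j → f i + f j ≤ sum f
+≤sum f {zero}  {zero}  i≢j = contradiction refl i≢j
+≤sum f {zero}  {suc j} _   = +-monoʳ-≤ (f zero) (≤sum (f ∘ suc) j)
+≤sum f {suc i} {zero}  _   =
  ≤-trans (≤-reflexive (+-comm (f (suc i)) (f zero))) (+-monoʳ-≤ (f zero) (≤sum (f ∘ suc) i))
+≤sum f {suc i} {suc j} i≢j = ≤-trans (+≤sum (f ∘ suc) (i≢j ∘ cong suc)) (m≤n+m _ (f zero))

sum-single : ∀ {n} (f : Fin n → ℕ) i → (∀ j → j ≢ i → f j ≡ 0) → sum f ≡ f i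
sum-single {suc n} f i others = begin
  sum f                        ≡⟨ sum-remove {i = i} f ⟩
  f i + sum (f ∘ punchIn i)    ≡⟨ cong (f i +_) (sum-zero (λ j → others _ (punchInᵢ≢i i j))) ⟩
  f i + 0                      ≡⟨ +-identityʳ (f i) ⟩
  f i                          ∎
  where open ≡-Reasoning

sum-const-1 : ∀ n → ∑[ i < n ] 1 ≡ n
sum-const-1 zero    = refl
sum-const-1 (suc n) = cong suc (sum-const-1 n)

sum≡+sum-pred : ∀ {n} (f : Fin n → ℕ) → (∀ i → f i ≢ 0) → sum f ≡ n + ∑[ i < n ] (f i ∸ 1)
sum≡+sum-pred {zero}  f _ = refl
sum≡+sum-pred {suc n} f f≢0 with f zero | f≢0 zero
... | zero  | 0≢0 = contradiction refl 0≢0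
... | suc x | _   = cong suc (begin
  x + sum (f ∘ suc)                              ≡⟨ cong (x +_) (sum≡+sum-pred (f ∘ suc) (f≢0 ∘ suc)) ⟩
  x + (n + ∑[ i < n ] (f (suc i) ∸ 1))           ≡⟨ x∙yz≈y∙xz x n _ ⟩
  n + (x + ∑[ i < n ] (f (suc i) ∸ 1))           ∎)
  where open ≡-Reasoning

sum-pred-bound : ∀ {n} (f : Fin n → ℕ) → (∀ i j → f i ≡ 0 → f j ≡ 0 → i ≡ j) →
                 n + ∑[ i < n ] (f i ∸ 1) ≤ suc (sum f)
sum-pred-bound {zero}  f _ = z≤n
sum-pred-bound {suc n} f zero-unique with f zero in f0≡
... | zero  = ≤-reflexive (cong suc (sym (sum≡+sum-pred (f ∘ suc) nonzero)))
  where
  nonzero : ∀ i → f (suc i) ≢ 0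
  nonzero i fi≡0 with zero-unique zero (suc i) f0≡ fi≡0
  ... | ()
... | suc x = begin
  suc n + (x + S)          ≡⟨ cong suc (x∙yz≈y∙xz n x S) ⟩
  suc x + (n + S)          ≤⟨ +-monoʳ-≤ (suc x) (sum-pred-bound (f ∘ suc) (λ i j p q → suc-injectiveᶠ (zero-unique _ _ p q))) ⟩
  suc x + suc (sum (f ∘ suc)) ≡⟨ +-suc (suc x) _ ⟩
  suc (suc x + sum (f ∘ suc)) ∎
  where
  open ≤-Reasoning
  S = ∑[ i < n ] (f (suc i) ∸ 1)

module _ {A : Set} {P : A → Set} (P? : Decidable P) where

  count : List A → ℕ
  count xs = length (filter P? xs)

  count-∷ : ∀ x xs → count (x ∷ xs) ≡ 𝟙 (P? x) + count xs
  count-∷ x xs with P? x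
  ... | yes _ = refl
  ... | no _  = refl

  count-++ : ∀ xs ys → count (xs ++ ys) ≡ count xs + count ys
  count-++ xs ys = trans (cong length (filter-++ P? xs ys)) (length-++ (filter P? xs))

  count-tabulate : ∀ {n} (h : Fin n → A) → count (tabulate h) ≡ ∑[ i < n ] 𝟙 (P? (h i))
  count-tabulate {zero}  h = refl
  count-tabulate {suc n} h = trans (count-∷ (h zero) _) (cong (𝟙 (P? (h zero)) +_) (count-tabulate (h ∘ suc)))

  count-concatMap : ∀ {B : Set} {n} (F : B → List A) (h : Fin n → B) →
                    count (concatMap F (tabulate h)) ≡ ∑[ i < n ] count (F (h i))
  count-concatMap {n = zero}  F h = refl
  count-concatMap {n = suc n} F h =
    trans (count-++ (F (h zero)) _) (cong (count (F (h zero)) +_) (count-concatMap F (h ∘ suc)))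

count-allV : ∀ {n k} {P : BV n k → Set} (P? : Decidable P) →
             count P? (allV n k) ≡ 𝟙 (P? left) + (𝟙 (P? right) + ∑[ i < n ] ∑[ j < k ] 𝟙 (P? (inner i j)))
count-allV {n} {k} P? = begin
  count P? (allV n k)                               ≡⟨ count-∷ P? left _ ⟩
  𝟙 (P? left) + count P? (right ∷ pages)            ≡⟨ cong (𝟙 (P? left) +_) (count-∷ P? right _) ⟩
  𝟙 (P? left) + (𝟙 (P? right) + count P? pages)    ≡⟨ cong (λ z → 𝟙 (P? left) + (𝟙 (P? right) + z)) pages-count ⟩
  𝟙 (P? left) + (𝟙 (P? right) + ∑[ i < n ] ∑[ j < k ] 𝟙 (P? (inner i j))) ∎
  where
  open ≡-Reasoning
  pages = concatMap (λ i → map (inner i) (allFin k)) (allFin n)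
  pages-count : count P? pages ≡ ∑[ i < n ] ∑[ j < k ] 𝟙 (P? (inner i j))
  pages-count = trans (count-concatMap P? (λ i → map (inner i) (allFin k)) (id {A = Fin n})) (sum-cong-≗ λ i →
    trans (cong (count P?) (map-tabulate id (inner i))) (count-tabulate P? (inner i)))

inner-injectiveˡ : ∀ {n k} {i i' : Fin n} {j j' : Fin k} → inner i j ≡ inner i' j' → i ≡ i'
inner-injectiveˡ refl = refl

inner-injectiveʳ : ∀ {n k} {i i' : Fin n} {j j' : Fin k} → inner i j ≡ inner i' j' → j ≡ j'
inner-injectiveʳ refl = refl

adj-left : ∀ {n k} {y : BV n k} → Adj left y → y ≡ right ⊎ ∃₂ λ i j → y ≡ inner i j × toℕ j ≡ 0
adj-left (inj₁ e-lr)             = inj₁ refl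
adj-left (inj₁ (e-left i j j≡0)) = inj₂ (i , j , refl , j≡0)

data Below {n k} (i : Fin n) (j : Fin k) : BV n k → Set where
  left-below  : toℕ j ≡ 0 → Below i j left
  inner-below : ∀ {j'} → toℕ j ≡ suc (toℕ j') → Below i j (inner i j')

data Above {n k} (i : Fin n) (j : Fin k) : BV n k → Set where
  right-above : suc (toℕ j) ≡ k → Above i j right
  inner-above : ∀ {j'} → toℕ j' ≡ suc (toℕ j) → Above i j (inner i j')

adj-inner : ∀ {n k} {i : Fin n} {j : Fin k} {y} → Adj (inner i j) y → Below i j y ⊎ Above i j y
adj-inner (inj₁ (e-step _ _ _ j'≡j+1)) = inj₂ (inner-above j'≡j+1)
adj-inner (inj₁ (e-right _ _ j+1≡k))   = inj₂ (right-above j+1≡k)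
adj-inner (inj₂ (e-left _ _ j≡0))      = inj₁ (left-below j≡0)
adj-inner (inj₂ (e-step _ _ _ j≡j'+1)) = inj₁ (inner-below j≡j'+1)

Below-unique : ∀ {n k} {i : Fin n} {j : Fin k} {y y'} → Below i j y → Below i j y' → y ≡ y'
Below-unique (left-below _)    (left-below _)    = refl
Below-unique (left-below j≡0)  (inner-below j≡)  = contradiction (trans (sym j≡0) j≡) 0≢1+n
Below-unique (inner-below j≡)  (left-below j≡0)  = contradiction (trans (sym j≡0) j≡) 0≢1+n
Below-unique (inner-below j≡)  (inner-below j≡′) =
  cong (inner _) (toℕ-injective (suc-injective (trans (sym j≡) j≡′)))

Above-unique : ∀ {n k} {i : Fin n} {j : Fin k} {y y'} → Above i j y → Above i j y' → y ≡ y'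
Above-unique (right-above _)           (right-above _)           = refl
Above-unique (right-above j+1≡k)       (inner-above {j'} j'≡j+1) = contradiction (trans j'≡j+1 j+1≡k) (<⇒≢ (toℕ<n j'))
Above-unique (inner-above {j'} j'≡j+1) (right-above j+1≡k)       = contradiction (trans j'≡j+1 j+1≡k) (<⇒≢ (toℕ<n j'))
Above-unique (inner-above j'≡j+1)      (inner-above j''≡j+1)     =
  cong (inner _) (toℕ-injective (trans j'≡j+1 (sym j''≡j+1)))

Spine : ∀ {n k} → BV n k → Set
Spine x = x ≡ left ⊎ x ≡ right

-- Inner vertices have degree 2: their neighbours lie below or above them.
degree≥3⇒spine : ∀ {n k} {x a b c : BV n k} → Adj x a → Adj x b → Adj x c →
                 a ≢ b → a ≢ c → b ≢ c → Spine x
degree≥3⇒spine {x = left}      _   _   _   _   _   _   = inj₁ refl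
degree≥3⇒spine {x = right}     _   _   _   _   _   _   = inj₂ refl
degree≥3⇒spine {x = inner i j} x~a x~b x~c a≢b a≢c b≢c with adj-inner x~a | adj-inner x~b | adj-inner x~c
... | inj₁ a↓ | inj₁ b↓ | _       = contradiction (Below-unique a↓ b↓) a≢b
... | inj₂ a↑ | inj₂ b↑ | _       = contradiction (Above-unique a↑ b↑) a≢b
... | inj₁ a↓ | inj₂ _  | inj₁ c↓ = contradiction (Below-unique a↓ c↓) a≢c
... | inj₁ _  | inj₂ b↑ | inj₂ c↑ = contradiction (Above-unique b↑ c↑) b≢c
... | inj₂ _  | inj₁ b↓ | inj₁ c↓ = contradiction (Below-unique b↓ c↓) b≢c
... | inj₂ a↑ | inj₁ _  | inj₂ c↑ = contradiction (Above-unique a↑ c↑) a≢c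

suc-toℕ-opposite : ∀ {k} (j : Fin k) → suc (toℕ (opposite j)) ≡ k ∸ toℕ j
suc-toℕ-opposite j = trans (cong suc (opposite-prop j)) (sym (+-∸-assoc 1 (toℕ<n j)))

opposite-first : ∀ {k} (j : Fin k) → toℕ j ≡ 0 → suc (toℕ (opposite j)) ≡ k
opposite-first j j≡0 = trans (suc-toℕ-opposite j) (cong (_ ∸_) j≡0)

opposite-last : ∀ {k} (j : Fin k) → suc (toℕ j) ≡ k → toℕ (opposite j) ≡ 0
opposite-last j j+1≡k = trans (opposite-prop j) (trans (cong (_∸ suc (toℕ j)) (sym j+1≡k)) (n∸n≡0 (suc (toℕ j))))

opposite-step : ∀ {k} (j j' : Fin k) → toℕ j' ≡ suc (toℕ j) → toℕ (opposite j) ≡ suc (toℕ (opposite j'))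
opposite-step {k} j j' j'≡j+1 = trans (opposite-prop j) (trans (cong (k ∸_) (sym j'≡j+1)) (sym (suc-toℕ-opposite j')))

relabelPages : ∀ {n k} → (Fin n → Fin n) → BV n k → BV n k
relabelPages π left        = left
relabelPages π right       = right
relabelPages π (inner i j) = inner (π i) j

reflectPages : ∀ {n k} → (Fin n → Fin n) → BV n k → BV n k
reflectPages π left        = right
reflectPages π right       = left
reflectPages π (inner i j) = inner (π i) (opposite j)

relabelPages-edge : ∀ {n k} (π : Fin n → Fin n) {x y : BV n k} → Edge x y → Edge (relabelPages π x) (relabelPages π y)
relabelPages-edge π e-lr                  = e-lr
relabelPages-edge π (e-left i j j≡0)      = e-left (π i) j j≡0
relabelPages-edge π (e-step i j j' j'≡)   = e-step (π i) j j' j'≡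
relabelPages-edge π (e-right i j j+1≡k)   = e-right (π i) j j+1≡k

reflectPages-edge : ∀ {n k} (π : Fin n → Fin n) {x y : BV n k} → Edge x y → Edge (reflectPages π y) (reflectPages π x)
reflectPages-edge π e-lr                = e-lr
reflectPages-edge π (e-left i j j≡0)    = e-right (π i) (opposite j) (opposite-first j j≡0)
reflectPages-edge π (e-step i j j' j'≡) = e-step (π i) (opposite j') (opposite j) (opposite-step j j' j'≡)
reflectPages-edge π (e-right i j j+1≡k) = e-left (π i) (opposite j) (opposite-last j j+1≡k)

relabelPages-inverse : ∀ {n k} {π ρ : Fin n → Fin n} → (∀ i → ρ (π i) ≡ i) →
                       ∀ (x : BV n k) → relabelPages ρ (relabelPages π x) ≡ x
relabelPages-inverse ρπ left        = refl
relabelPages-inverse ρπ right       = refl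
relabelPages-inverse ρπ (inner i j) = cong (λ i → inner i j) (ρπ i)

reflectPages-inverse : ∀ {n k} {π ρ : Fin n → Fin n} → (∀ i → ρ (π i) ≡ i) →
                       ∀ (x : BV n k) → reflectPages ρ (reflectPages π x) ≡ x
reflectPages-inverse ρπ left        = refl
reflectPages-inverse ρπ right       = refl
reflectPages-inverse ρπ (inner i j) = cong₂ inner (ρπ i) (opposite-involutive j)

autOfInverses : ∀ {m n} (f g : Book m n → Book m n) → (∀ x → g (f x) ≡ x) → (∀ x → f (g x) ≡ x) →
                (∀ {x y} → Adj x y → Adj (f x) (f y)) → (∀ {x y} → Adj x y → Adj (g x) (g y)) → Aut m n
autOfInverses f g gf fg f-adj g-adj = record
  { fun = f ; inv = g ; inv-l = gf ; inv-r = fg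
  ; adj→ = λ _ _ → f-adj
  ; adj← = λ x y fx~fy → subst₂ Adj (gf x) (gf y) (g-adj fx~fy) }

permutePages : ∀ {m n} → Permutation′ n → Aut m n
permutePages π = autOfInverses (relabelPages (π ⟨$⟩ʳ_)) (relabelPages (π ⟨$⟩ˡ_))
  (relabelPages-inverse (λ _ → inverseˡ π)) (relabelPages-inverse (λ _ → inverseʳ π))
  (⊎-map (relabelPages-edge _) (relabelPages-edge _)) (⊎-map (relabelPages-edge _) (relabelPages-edge _))

reflectBook : ∀ {m n} → Permutation′ n → Aut m n
reflectBook π = autOfInverses (reflectPages (π ⟨$⟩ʳ_)) (reflectPages (π ⟨$⟩ˡ_))
  (reflectPages-inverse (λ _ → inverseˡ π)) (reflectPages-inverse (λ _ → inverseʳ π))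
  (⊎-swap ∘ ⊎-map (reflectPages-edge _) (reflectPages-edge _)) (⊎-swap ∘ ⊎-map (reflectPages-edge _) (reflectPages-edge _))

aut-injective : ∀ {m n} (σ : Aut m n) → Injective _≡_ _≡_ (fun σ)
aut-injective σ {x} {y} σx≡σy = trans (sym (inv-l σ x)) (trans (cong (inv σ) σx≡σy) (inv-l σ y))

transpose-fixes : ∀ {n} {i i' x : Fin n} → x ≢ i → x ≢ i' → Components.transpose i i' x ≡ x
transpose-fixes {i = i} {i'} {x} x≢i x≢i' with x ≟ᶠ i
... | yes x≡i = contradiction x≡i x≢i
... | no _ with x ≟ᶠ i'
...   | yes x≡i' = contradiction x≡i' x≢i'
...   | no _     = refl

transpose-moves : ∀ {n} (i i' : Fin n) → Components.transpose i i' i ≡ i'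
transpose-moves i i' with i ≟ᶠ i
... | yes _   = refl
... | no i≢i  = contradiction refl i≢i

transpose-invariant : ∀ {n} {A : Set} (w : Fin n → A) {i i'} → w i ≡ w i' →
                      ∀ x → w (Components.transpose i i' x) ≡ w x
transpose-invariant w {i} {i'} wi≡wi' x with x ≟ᶠ i
... | yes refl = sym wi≡wi'
... | no _ with x ≟ᶠ i'
...   | yes refl = wi≡wi'
...   | no _     = refl

swapPages : ∀ {m n} → Fin n → Fin n → Aut m n
swapPages i i' = permutePages (transpose i i')

swapPages-identity : ∀ {k n} {i i' : Fin n} → IsIdentity (swapPages {2 + suc k} i i') → i ≡ i'
swapPages-identity {i = i} {i'} σ-id =
  sym (trans (sym (transpose-moves i i')) (inner-injectiveˡ (σ-id (inner i zero))))

missed-pages-equal : ∀ {k n} (S : VSubset (2 + suc k) n) → Determining (2 + suc k) n S →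
                     ∀ i i' → (∀ j → S (inner i j) ≢ true) → (∀ j → S (inner i' j) ≢ true) → i ≡ i'
missed-pages-equal {k} {n} S S-det i i' i-missed i'-missed = swapPages-identity (S-det σ fixes)
  where
  σ : Aut (2 + suc k) n
  σ = swapPages i i'
  fixes : ∀ x → S x ≡ true → fun σ x ≡ x
  fixes left        _   = refl
  fixes right       _   = refl
  fixes (inner x j) x∈S = cong (λ y → inner y j)
    (transpose-fixes (λ { refl → i-missed j x∈S }) (λ { refl → i'-missed j x∈S }))

distinguishing⇒pages-distinct : ∀ {k n d} (c : Coloring (2 + suc k) n d) → Distinguishing (2 + suc k) n c →
                                ∀ i i' → (∀ j → c (inner i j) ≡ c (inner i' j)) → i ≡ i'
distinguishing⇒pages-distinct {k} {n} c dist i i' same-word = swapPages-identity (dist σ preserves)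
  where
  σ : Aut (2 + suc k) n
  σ = swapPages i i'
  preserves : ∀ x → c (fun σ x) ≡ c x
  preserves left        = refl
  preserves right       = refl
  preserves (inner x j) = transpose-invariant (λ y → c (inner y j)) (same-word j) x

module _ {k n} (S : VSubset (2 + suc k) n) (S-det : Determining (2 + suc k) n S) where

  private
    S? : Decidable (λ x → S x ≡ true)
    S? x = S x ≟ᵇ true

    hits : Fin n → ℕ
    hits i = ∑[ j < suc k ] 𝟙 (S? (inner i j))

    L R H G : ℕ
    L = 𝟙 (S? left)
    R = 𝟙 (S? right)
    H = sum hits
    G = ∑[ i < n ] (hits i ∸ 1)

    size≡ : size (2 + suc k) n S ≡ L + (R + H)
    size≡ = count-allV S?

    one-missed-page : ∀ i i' → hits i ≡ 0 → hits i' ≡ 0 → i ≡ i'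
    one-missed-page i i' i-missed i'-missed =
      missed-pages-equal {k} S S-det i i' (missed i-missed) (missed i'-missed)
      where
      missed : ∀ {i} → hits i ≡ 0 → ∀ j → S (inner i j) ≢ true
      missed {i} hits≡0 j = 𝟙≡0⇒¬ (S? (inner i j)) (sum≡0⇒zero (λ j → 𝟙 (S? (inner i j))) hits≡0 j)

    n+G≤1+H : n + G ≤ suc H
    n+G≤1+H = sum-pred-bound hits one-missed-page

  determining-size-bound : n ≤ suc (size (2 + suc k) n S)
  determining-size-bound = begin
    n                    ≤⟨ m≤m+n n G ⟩
    n + G                ≤⟨ n+G≤1+H ⟩
    suc H                ≤⟨ s≤s (≤-trans (m≤n+m H R) (m≤n+m (R + H) L)) ⟩
    suc (L + (R + H))    ≡⟨ cong suc size≡ ⟨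
    suc (size (2 + suc k) n S) ∎
    where open ≤-Reasoning

  determining-tight : suc (size (2 + suc k) n S) ≡ n →
                      S left ≢ true × S right ≢ true ×
                      (∀ i j j' → S (inner i j) ≡ true → S (inner i j') ≡ true → j ≡ j')
  determining-tight tight = 𝟙≡0⇒¬ (S? left) L≡0 , 𝟙≡0⇒¬ (S? right) R≡0 , one-per-page
    where
    L+[R+G]≡0 : L + (R + G) ≡ 0
    L+[R+G]≡0 = n≤0⇒n≡0 (+-cancelʳ-≤ H (L + (R + G)) 0 (begin
      L + (R + G) + H    ≡⟨ rearrange L R G H ⟩
      L + (R + H) + G    ≤⟨ s≤s⁻¹ (subst (λ z → z + G ≤ suc H) (trans (sym tight) (cong suc size≡)) n+G≤1+H) ⟩
      H                  ∎))
      where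
      open ≤-Reasoning
      rearrange : ∀ l r g h → l + (r + g) + h ≡ l + (r + h) + g
      rearrange = solve-∀
    L≡0 : L ≡ 0
    L≡0 = m+n≡0⇒m≡0 L L+[R+G]≡0
    R≡0 : R ≡ 0
    R≡0 = m+n≡0⇒m≡0 R (m+n≡0⇒n≡0 L L+[R+G]≡0)
    hits≤1 : ∀ i → hits i ≤ 1
    hits≤1 i = m∸n≡0⇒m≤n (sum≡0⇒zero _ (m+n≡0⇒n≡0 R (m+n≡0⇒n≡0 L L+[R+G]≡0)) i)
    one-per-page : ∀ i j j' → S (inner i j) ≡ true → S (inner i j') ≡ true → j ≡ j'
    one-per-page i j j' j∈S j'∈S with j ≟ᶠ j'
    ... | yes j≡j' = j≡j'
    ... | no j≢j'  = contradiction (≤-trans two≤hits (hits≤1 i)) (λ { (s≤s ()) })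
      where
      two≤hits : 2 ≤ hits i
      two≤hits = subst₂ (λ a b → a + b ≤ hits i) (𝟙-yes (S? _) j∈S) (𝟙-yes (S? _) j'∈S)
                        (+≤sum (λ j → 𝟙 (S? (inner i j))) j≢j')

outside : ∀ {k n d} → Coloring (2 + k) n d → Fin d → VSubset (2 + k) n
outside c t x = does (¬? (c x ≟ᶠ t))

outside-true : ∀ {k n d} (c : Coloring (2 + k) n d) t x → c x ≢ t → outside c t x ≡ true
outside-true c t x = dec-true (¬? (c x ≟ᶠ t))

outside-true⁻¹ : ∀ {k n d} (c : Coloring (2 + k) n d) t x → outside c t x ≡ true → c x ≢ t
outside-true⁻¹ c t x x∈ cx≡t = contradiction (trans (sym x∈) (dec-false (¬? (c x ≟ᶠ t)) (λ cx≢t → cx≢t cx≡t))) λ ()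

size-outside : ∀ {k n d} (c : Coloring (2 + k) n d) t → size (2 + k) n (outside c t) ≡ outsideClass (2 + k) n c t
size-outside {k} {n} c t =
  cong length (filter-≐ (λ x → outside c t x ≟ᵇ true) (λ x → ¬? (c x ≟ᶠ t)) (outside-true⁻¹ c t _ , outside-true c t _) (allV n k))

distinguishing⇒outside-determining : ∀ {k n d} (c : Coloring (2 + k) n d) t → Distinguishing (2 + k) n c →
                                     Determining (2 + k) n (outside c t)
distinguishing⇒outside-determining c t dist σ fixes = dist σ preserves
  where
  preserves : ∀ x → c (fun σ x) ≡ c x
  preserves x with c x ≟ᶠ t
  ... | no cx≢t = cong c (fixes x (outside-true c t x cx≢t))
  ... | yes cx≡t with c (fun σ x) ≟ᶠ t
  ...   | yes cσx≡t = trans cσx≡t (sym cx≡t)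
  ...   | no cσx≢t  = contradiction (trans (cong c (aut-injective σ (fixes (fun σ x) (outside-true c t _ cσx≢t)))) cx≡t) cσx≢t

outsideClass-bound : ∀ {k n d} (c : Coloring (2 + suc k) n d) → Distinguishing (2 + suc k) n c →
                     ∀ t → n ≤ suc (outsideClass (2 + suc k) n c t)
outsideClass-bound c dist t =
  subst (λ z → _ ≤ suc z) (size-outside c t) (determining-size-bound _ (distinguishing⇒outside-determining c t dist))

module _ {k n} (σ : Aut (2 + suc k) (2 + n)) where

  private
    σ-injective : Injective _≡_ _≡_ (fun σ)
    σ-injective = aut-injective σ

    last : Fin (suc k)
    last = fromℕ k

    last-right : ∀ (i : Fin (2 + n)) → Edge (inner i last) right
    last-right i = e-right i last (cong suc (toℕ-fromℕ k))

  left-spine : Spine (fun σ left)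
  left-spine = degree≥3⇒spine (adj→ σ left right (inj₁ e-lr))
    (adj→ σ left (inner zero zero) (inj₁ (e-left zero zero refl)))
    (adj→ σ left (inner (suc zero) zero) (inj₁ (e-left (suc zero) zero refl)))
    (λ e → contradiction (σ-injective e) λ ()) (λ e → contradiction (σ-injective e) λ ())
    (λ e → contradiction (σ-injective e) λ ())

  right-spine : Spine (fun σ right)
  right-spine = degree≥3⇒spine (adj→ σ right left (inj₂ e-lr))
    (adj→ σ right (inner zero last) (inj₂ (last-right zero)))
    (adj→ σ right (inner (suc zero) last) (inj₂ (last-right (suc zero))))
    (λ e → contradiction (σ-injective e) λ ()) (λ e → contradiction (σ-injective e) λ ())
    (λ e → contradiction (σ-injective e) λ ())

module _ {k n} (σ : Aut (2 + suc k) n) (σ-left : fun σ left ≡ left) (σ-right : fun σ right ≡ right) where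

  private
    σ-injective : Injective _≡_ _≡_ (fun σ)
    σ-injective = aut-injective σ

    Agrees : Fin n → Fin n → ℕ → Set
    Agrees i i' t = ∀ j → toℕ j ≤ t → fun σ (inner i j) ≡ inner i' j

    -- The next vertex of page i is a neighbour of inner i' t other than the previous one.
    agrees-suc : ∀ {i i' t} → Agrees i i' t → Agrees i i' (suc t)
    agrees-suc {i} {i'} {t} agrees j j≤t+1 with m≤n⇒m<n∨m≡n j≤t+1
    ... | inj₁ j<t+1 = agrees j (s≤s⁻¹ j<t+1)
    ... | inj₂ j≡t+1 = next (adj-inner (subst (λ y → Adj y (fun σ (inner i j))) (agrees jp (≤-reflexive jp≡t)) σjp~σj)) refl
      where
      t<k : t < suc k
      t<k = <⇒≤ (subst (_< suc k) j≡t+1 (toℕ<n j))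
      jp : Fin (suc k)
      jp = fromℕ< t<k
      jp≡t : toℕ jp ≡ t
      jp≡t = toℕ-fromℕ< t<k
      σjp~σj : Adj (fun σ (inner i jp)) (fun σ (inner i j))
      σjp~σj = adj→ σ (inner i jp) (inner i j) (inj₁ (e-step i jp j (trans j≡t+1 (cong suc (sym jp≡t)))))
      next : ∀ {y} → Below i' jp y ⊎ Above i' jp y → fun σ (inner i j) ≡ y → fun σ (inner i j) ≡ inner i' j
      next (inj₁ (left-below _)) σj≡left = contradiction (σ-injective (trans σj≡left (sym σ-left))) λ ()
      next (inj₁ (inner-below {j''} jp≡j''+1)) σj≡ =
        contradiction (subst (_≤ t) (trans (cong toℕ j''≡j) j≡t+1) j''≤t) (1+n≰n {t})
        where
        j''≤t : toℕ j'' ≤ t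
        j''≤t = ≤-trans (n≤1+n _) (≤-reflexive (trans (sym jp≡j''+1) jp≡t))
        j''≡j : j'' ≡ j
        j''≡j = inner-injectiveʳ (σ-injective (trans (agrees j'' j''≤t) (sym σj≡)))
      next (inj₂ (right-above _)) σj≡right = contradiction (σ-injective (trans σj≡right (sym σ-right))) λ ()
      next (inj₂ (inner-above {j''} j''≡jp+1)) σj≡ =
        trans σj≡ (cong (inner i') (toℕ-injective (trans j''≡jp+1 (trans (cong suc jp≡t) (sym j≡t+1)))))

  pages-preserved : ∀ i → ∃ λ i' → ∀ j → fun σ (inner i j) ≡ inner i' j
  pages-preserved i with adj-left (subst (λ y → Adj y (fun σ (inner i zero))) σ-left (adj→ σ left (inner i zero) (inj₁ (e-left i zero refl))))
  ... | inj₁ σv≡right = contradiction (σ-injective (trans σv≡right (sym σ-right))) λ ()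
  ... | inj₂ (i' , j' , σv≡ , j'≡0) = i' , λ j → agrees (toℕ j) j ≤-refl
    where
    agrees : ∀ t → Agrees i i' t
    agrees zero    j j≤0 = begin
      fun σ (inner i j)      ≡⟨ cong (λ j → fun σ (inner i j)) j≡0 ⟩
      fun σ (inner i zero)   ≡⟨ σv≡ ⟩
      inner i' j'            ≡⟨ cong (inner i') (trans (toℕ-injective j'≡0) (sym j≡0)) ⟩
      inner i' j             ∎
      where
      open ≡-Reasoning
      j≡0 : j ≡ zero
      j≡0 = toℕ-injective (n≤0⇒n≡0 j≤0)
    agrees (suc t) = agrees-suc (agrees t)

-- A page word over the colours Fin (suc d) with at most one letter different from a
-- background colour t: mark p a has the letter punchIn t a at position p.
data Sparse (k d : ℕ) : Set where
  blank : Sparse k d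
  mark  : Fin k → Fin d → Sparse k d

spell : ∀ {k d} → Fin (suc d) → Sparse k d → Fin k → Fin (suc d)
spell t blank      j = t
spell t (mark p a) j with p ≟ᶠ j
... | yes _ = punchIn t a
... | no  _ = t

reflect : ∀ {k d} → Sparse k d → Sparse k d
reflect blank      = blank
reflect (mark p a) = mark (opposite p) a

weight : ∀ {k d} → Sparse k d → ℕ
weight blank      = 0
weight (mark _ _) = 1

encode : ∀ {k d} → Sparse k d → Fin (suc (k * d))
encode blank      = zero
encode (mark p a) = suc (combine p a)

spell-mark : ∀ {k d} t p (a : Fin d) → spell t (mark {k} p a) p ≡ punchIn t a
spell-mark t p a with p ≟ᶠ p
... | yes _   = refl
... | no p≢p  = contradiction refl p≢p

spell-mark-≢ : ∀ {k d} t {p j} (a : Fin d) → p ≢ j → spell t (mark {k} p a) j ≡ t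
spell-mark-≢ t {p} {j} a p≢j with p ≟ᶠ j
... | yes p≡j = contradiction p≡j p≢j
... | no _    = refl

spell≡punchIn : ∀ {k d} {t} {s : Sparse k d} {j a} → spell t s j ≡ punchIn t a → s ≡ mark j a
spell≡punchIn {t = t} {blank} {a = a} t≡ = contradiction (sym t≡) (punchInᵢ≢i t a)
spell≡punchIn {t = t} {mark p a'} {j} {a} eq with p ≟ᶠ j
... | yes refl = cong (mark p) (punchIn-injective t a' a eq)
... | no _     = contradiction (sym eq) (punchInᵢ≢i t a)

spell-injective : ∀ {k d} {t} {s s' : Sparse k d} → (∀ j → spell t s j ≡ spell t s' j) → s ≡ s'
spell-injective {s' = mark p a}         same = spell≡punchIn (trans (same p) (spell-mark _ p a))
spell-injective {s = mark p a} {blank}  same = sym (spell≡punchIn (trans (sym (same p)) (spell-mark _ p a)))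
spell-injective {s = blank}    {blank}  _    = refl

spell-reflect : ∀ {k d} t (s : Sparse k d) j → spell t (reflect s) j ≡ spell t s (opposite j)
spell-reflect t blank      j = refl
spell-reflect t (mark p a) j with opposite p ≟ᶠ j | p ≟ᶠ opposite j
... | yes _     | yes _    = refl
... | no _      | no _     = refl
... | yes op≡j  | no p≢oj  = contradiction (trans (sym (opposite-involutive p)) (cong opposite op≡j)) p≢oj
... | no op≢j   | yes p≡oj = contradiction (trans (cong opposite p≡oj) (opposite-involutive j)) op≢j

reflect-involutive : ∀ {k d} (s : Sparse k d) → reflect (reflect s) ≡ s
reflect-involutive blank      = refl
reflect-involutive (mark p a) = cong (λ p → mark p a) (opposite-involutive p)

weight-spell : ∀ {k d} t (s : Sparse k d) → ∑[ j < k ] 𝟙 (¬? (spell t s j ≟ᶠ t)) ≡ weight s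
weight-spell {k} t blank = sum-zero {k} (λ j → 𝟙-no (¬? (t ≟ᶠ t)) (λ t≢t → t≢t refl))
weight-spell t (mark p a) = trans (sum-single _ p off-mark) (𝟙-yes (¬? (_ ≟ᶠ t)) on-mark)
  where
  on-mark : spell t (mark p a) p ≢ t
  on-mark = subst (_≢ t) (sym (spell-mark t p a)) (punchInᵢ≢i t a)
  off-mark : ∀ j → j ≢ p → 𝟙 (¬? (spell t (mark p a) j ≟ᶠ t)) ≡ 0
  off-mark j j≢p = 𝟙-no (¬? (_ ≟ᶠ t)) (λ s≢t → s≢t (spell-mark-≢ t a (j≢p ∘ sym)))

sparse-view : ∀ {k d} (t : Fin (suc d)) (w : Fin k → Fin (suc d)) →
              (∀ j j' → w j ≢ t → w j' ≢ t → j ≡ j') → ∃ λ s → ∀ j → spell t s j ≡ w j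
sparse-view t w one-off with any? (λ j → ¬? (w j ≟ᶠ t))
... | no none = blank , λ j → sym (decidable-stable (w j ≟ᶠ t) (λ wj≢t → none (j , wj≢t)))
... | yes (p , wp≢t) = mark p (punchOut (wp≢t ∘ sym)) , spelled
  where
  spelled : ∀ j → spell t (mark p (punchOut (wp≢t ∘ sym))) j ≡ w j
  spelled j with p ≟ᶠ j
  ... | yes refl = punchIn-punchOut (wp≢t ∘ sym)
  ... | no p≢j   = sym (decidable-stable (w j ≟ᶠ t) (λ wj≢t → p≢j (one-off p j wp≢t wj≢t)))

encode-injective : ∀ {k d} → Injective _≡_ _≡_ (encode {k} {d})
encode-injective {x = blank}    {blank}      _  = refl
encode-injective {x = mark p a} {mark p' a'} eq with combine-injective p a p' a' (suc-injectiveᶠ eq)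
... | refl , refl = refl

injective⇒surjective : ∀ {n m} (g : Fin n → Fin m) → Injective _≡_ _≡_ g → m ≤ n → ∀ y → ∃ λ x → g x ≡ y
injective⇒surjective {n} {suc m} g g-injective m≤n y with any? (λ x → g x ≟ᶠ y)
... | yes hit  = hit
... | no  miss = contradiction (injective⇒≤ h-injective) (<⇒≱ m≤n)
  where
  h : Fin n → Fin m
  h x = punchOut {i = y} {j = g x} (λ y≡gx → miss (x , sym y≡gx))
  h-injective : Injective _≡_ _≡_ h
  h-injective {x} {x'} = g-injective ∘ punchOut-injective {i = y} {g x} {g x'} _ _

sparse-surjective : ∀ {k d n} (s : Fin n → Sparse k d) → Injective _≡_ _≡_ s → suc (k * d) ≤ n →
                    ∀ w → ∃ λ i → s i ≡ w
sparse-surjective s s-injective bound w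
  with i , code≡ ← injective⇒surjective (encode ∘ s) (s-injective ∘ encode-injective) bound (encode w)
  = i , encode-injective code≡

sparseColouring : ∀ {k n d} → Fin (suc d) → (Fin n → Sparse k d) → Coloring (2 + k) n (suc d)
sparseColouring t s left        = t
sparseColouring t s right       = t
sparseColouring t s (inner i j) = spell t (s i) j

outsideClass-sparseColouring : ∀ {k n d} t (s : Fin n → Sparse k d) →
                               outsideClass (2 + k) n (sparseColouring t s) t ≡ ∑[ i < n ] weight (s i)
outsideClass-sparseColouring {k} {n} t s = begin
  outsideClass (2 + k) n (sparseColouring t s) t
    ≡⟨ count-allV (λ x → ¬? (sparseColouring t s x ≟ᶠ t)) ⟩
  𝟙 (¬? (t ≟ᶠ t)) + (𝟙 (¬? (t ≟ᶠ t)) + ∑[ i < n ] ∑[ j < k ] 𝟙 (¬? (spell t (s i) j ≟ᶠ t)))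
    ≡⟨ cong₂ _+_ t-uncounted (cong₂ _+_ t-uncounted (sum-cong-≗ (weight-spell t ∘ s))) ⟩
  ∑[ i < n ] weight (s i)
    ∎
  where
  open ≡-Reasoning
  t-uncounted : 𝟙 (¬? (t ≟ᶠ t)) ≡ 0
  t-uncounted = 𝟙-no (¬? (t ≟ᶠ t)) (λ t≢t → t≢t refl)

distinguishing-≗ : ∀ {m n d} {c c' : Coloring m n d} → (∀ x → c x ≡ c' x) →
                   Distinguishing m n c → Distinguishing m n c'
distinguishing-≗ c≗c' dist σ preserves = dist σ (λ x → trans (c≗c' _) (trans (preserves x) (sym (c≗c' x))))

-- With at least as many pages as sparse words, every word is used, so the words are
-- closed under reflection and reflecting the book preserves the colouring.
sparseColouring-not-distinguishing : ∀ {k n d} t (s : Fin n → Sparse (suc k) d) → suc (suc k * d) ≤ n →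
                                     ¬ Distinguishing (2 + suc k) n (sparseColouring t s)
sparseColouring-not-distinguishing {k} {n} t s bound dist = contradiction (dist σ preserves left) λ ()
  where
  s-injective : Injective _≡_ _≡_ s
  s-injective {i} {i'} si≡si' =
    distinguishing⇒pages-distinct (sparseColouring t s) dist i i' (λ j → cong (λ w → spell t w j) si≡si')
  π : Fin n → Fin n
  π i = proj₁ (sparse-surjective s s-injective bound (reflect (s i)))
  s∘π : ∀ i → s (π i) ≡ reflect (s i)
  s∘π i = proj₂ (sparse-surjective s s-injective bound (reflect (s i)))
  π-involutive : ∀ i → π (π i) ≡ i
  π-involutive i = s-injective (begin
    s (π (π i))              ≡⟨ s∘π (π i) ⟩
    reflect (s (π i))        ≡⟨ cong reflect (s∘π i) ⟩
    reflect (reflect (s i))  ≡⟨ reflect-involutive (s i) ⟩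
    s i                      ∎)
    where open ≡-Reasoning
  σ : Aut (2 + suc k) n
  σ = reflectBook (permutation π π π-involutive π-involutive)
  preserves : ∀ x → sparseColouring t s (fun σ x) ≡ sparseColouring t s x
  preserves left        = refl
  preserves right       = refl
  preserves (inner i j) = begin
    spell t (s (π i)) (opposite j)          ≡⟨ cong (λ w → spell t w (opposite j)) (s∘π i) ⟩
    spell t (reflect (s i)) (opposite j)    ≡⟨ spell-reflect t (s i) (opposite j) ⟩
    spell t (s i) (opposite (opposite j))   ≡⟨ cong (spell t (s i)) (opposite-involutive j) ⟩
    spell t (s i) j                         ∎
    where open ≡-Reasoning

-- The colour of mark a occurs next to right (at the last position of page i₁) but
-- never next to left, so a colour-preserving automorphism cannot swap left and right.
sparseColouring-spine-fixed : ∀ {k n d} t (s : Fin (2 + n) → Sparse (suc k) d) →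
  ∀ a i₁ → s i₁ ≡ mark (fromℕ k) a → (∀ i → s i ≢ mark zero a) →
  (σ : Aut (2 + suc k) (2 + n)) → (∀ x → sparseColouring t s (fun σ x) ≡ sparseColouring t s x) →
  fun σ left ≡ left × fun σ right ≡ right
sparseColouring-spine-fixed {k} {n} t s a i₁ s-i₁ first-unmarked σ preserves = σ-left , σ-right
  where
  σ-injective : Injective _≡_ _≡_ (fun σ)
  σ-injective = aut-injective σ
  v : BV (2 + n) (suc k)
  v = inner i₁ (fromℕ k)
  v-colour : spell t (s i₁) (fromℕ k) ≡ punchIn t a
  v-colour = trans (cong (λ w → spell t w (fromℕ k)) s-i₁) (spell-mark t (fromℕ k) a)

  not-swapped : fun σ left ≢ right
  not-swapped σl≡r = from-left (adj-left (⊎-swap σv~left))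
    where
    σr≡l : fun σ right ≡ left
    σr≡l with right-spine σ
    ... | inj₁ σr≡l = σr≡l
    ... | inj₂ σr≡r = contradiction (σ-injective (trans σr≡r (sym σl≡r))) λ ()
    σv~left : Adj (fun σ v) left
    σv~left = subst (Adj (fun σ v)) σr≡l (adj→ σ v right (inj₁ (e-right i₁ (fromℕ k) (cong suc (toℕ-fromℕ k)))))
    from-left : fun σ v ≡ right ⊎ ∃₂ (λ i j → fun σ v ≡ inner i j × toℕ j ≡ 0) → ⊥
    from-left (inj₁ σv≡r) = contradiction (σ-injective (trans σv≡r (sym σl≡r))) λ ()
    from-left (inj₂ (i , j , σv≡ , j≡0)) = first-unmarked i (begin
      s i            ≡⟨ spell≡punchIn (trans (cong (sparseColouring t s) (sym σv≡)) (trans (preserves v) v-colour)) ⟩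
      mark j a       ≡⟨ cong (λ j → mark j a) (toℕ-injective j≡0) ⟩
      mark zero a    ∎)
      where open ≡-Reasoning

  σ-left : fun σ left ≡ left
  σ-left with left-spine σ
  ... | inj₁ σl≡l = σl≡l
  ... | inj₂ σl≡r = contradiction σl≡r not-swapped

  σ-right : fun σ right ≡ right
  σ-right with right-spine σ
  ... | inj₂ σr≡r = σr≡r
  ... | inj₁ σr≡l = contradiction (σ-injective (trans σr≡l (sym σ-left))) λ ()

sparseColouring-distinguishing : ∀ {k n d} t (s : Fin (2 + n) → Sparse (suc k) d) → Injective _≡_ _≡_ s →
  ∀ a i₁ → s i₁ ≡ mark (fromℕ k) a → (∀ i → s i ≢ mark zero a) →
  Distinguishing (2 + suc k) (2 + n) (sparseColouring t s)
sparseColouring-distinguishing t s s-injective a i₁ s-i₁ first-unmarked σ preserves = σ-identity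
  where
  spine-fixed = sparseColouring-spine-fixed t s a i₁ s-i₁ first-unmarked σ preserves

  σ-identity : IsIdentity σ
  σ-identity left        = proj₁ spine-fixed
  σ-identity right       = proj₂ spine-fixed
  σ-identity (inner i j) with pages-preserved σ (proj₁ spine-fixed) (proj₂ spine-fixed) i
  ... | i' , on-page = trans (on-page j) (cong (λ y → inner y j) (s-injective (spell-injective same-word)))
    where
    same-word : ∀ j → spell t (s i') j ≡ spell t (s i) j
    same-word j = trans (cong (sparseColouring t s) (sym (on-page j))) (preserves (inner i j))

tight-distinguishing⇒pages≤ : ∀ {k n d} (c : Coloring (2 + suc k) n (suc d)) t → Distinguishing (2 + suc k) n c →
                              suc (outsideClass (2 + suc k) n c t) ≡ n → n ≤ suc k * d
tight-distinguishing⇒pages≤ {k} {n} {d} c t dist tight =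
  ≮⇒≥ (λ bound → sparseColouring-not-distinguishing t s bound (distinguishing-≗ c≗sparse dist))
  where
  tight-set : outside c t left ≢ true × outside c t right ≢ true ×
              (∀ i j j' → outside c t (inner i j) ≡ true → outside c t (inner i j') ≡ true → j ≡ j')
  tight-set = determining-tight (outside c t) (distinguishing⇒outside-determining c t dist)
                                (trans (cong suc (size-outside c t)) tight)
  coloured-t : ∀ x → outside c t x ≢ true → c x ≡ t
  coloured-t x x∉ = decidable-stable (c x ≟ᶠ t) (x∉ ∘ outside-true c t x)
  page-view : ∀ i → ∃ λ w → ∀ j → spell t w j ≡ c (inner i j)
  page-view i = sparse-view t (λ j → c (inner i j)) λ j j' j≢t j'≢t →
    proj₂ (proj₂ tight-set) i j j' (outside-true c t _ j≢t) (outside-true c t _ j'≢t)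
  s : Fin n → Sparse (suc k) d
  s = proj₁ ∘ page-view
  c≗sparse : ∀ x → c x ≡ sparseColouring t s x
  c≗sparse left        = coloured-t left (proj₁ tight-set)
  c≗sparse right       = coloured-t right (proj₁ (proj₂ tight-set))
  c≗sparse (inner i j) = sym (proj₂ (page-view i) j)

negate : ∀ {k} → Fin k → Fin k
negate zero    = zero
negate (suc j) = suc (opposite j)

negate-injective : ∀ {k} → Injective _≡_ _≡_ (negate {k})
negate-injective {x = zero}  {zero}   _  = refl
negate-injective {x = suc j} {suc j'} eq =
  cong suc (trans (sym (opposite-involutive j)) (trans (cong opposite (suc-injectiveᶠ eq)) (opposite-involutive j')))

negate≡zero : ∀ {k} {j : Fin (suc k)} → negate j ≡ zero → j ≡ zero
negate≡zero {j = zero} _ = refl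

mark-injective : ∀ {k d} {p p' : Fin k} {a a' : Fin d} → mark p a ≡ mark p' a' → p ≡ p' × a ≡ a'
mark-injective refl = refl , refl

-- Page z ≥ 1 carries colour a at position −r mod (2 + k), where z = a (2 + k) + r.  Colour 0
-- comes with r ≠ 0, so never at position 0, and page 1 has it at the last position.
module Canonical (k n : ℕ) where

  q : ℕ
  q = suc n / (2 + k)

  q*[2+k]≤1+n : q * (2 + k) ≤ suc n
  q*[2+k]≤1+n = ≤-trans (m≤n+m (q * (2 + k)) (suc n % (2 + k))) (≤-reflexive (sym (m≡m%n+[m/n]*n (suc n) (2 + k))))

  pages≤codes : 2 + n ≤ suc q * (2 + k)
  pages≤codes = begin
    2 + n                                ≡⟨ cong suc (m≡m%n+[m/n]*n (suc n) (2 + k)) ⟩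
    suc (suc n % (2 + k)) + q * (2 + k)  ≤⟨ +-monoˡ-≤ (q * (2 + k)) (m%n<n (suc n) (2 + k)) ⟩
    suc q * (2 + k)                      ∎
    where open ≤-Reasoning

  code : Fin (2 + n) → Fin (suc q) × Fin (2 + k)
  code i = remQuot (2 + k) (inject≤ i pages≤codes)

  code-injective : Injective _≡_ _≡_ code
  code-injective {i} {i'} same-code = inject≤-injective _ _ i i' (begin
    inject≤ i pages≤codes                                   ≡⟨ combine-remQuot {suc q} (2 + k) _ ⟨
    combine (proj₁ (code i)) (proj₂ (code i))               ≡⟨ cong (λ c → combine (proj₁ c) (proj₂ c)) same-code ⟩
    combine (proj₁ (code i')) (proj₂ (code i'))             ≡⟨ combine-remQuot {suc q} (2 + k) _ ⟩
    inject≤ i' pages≤codes                                  ∎)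
    where open ≡-Reasoning

  pageMark : Fin (2 + n) → Sparse (2 + k) (suc q)
  pageMark zero    = blank
  pageMark (suc z) = mark (negate (proj₂ (code (suc z)))) (proj₁ (code (suc z)))

  pageMark-injective : Injective _≡_ _≡_ pageMark
  pageMark-injective {zero}  {zero}   _    = refl
  pageMark-injective {suc z} {suc z'} same with mark-injective same
  ... | r≡r' , a≡a' = code-injective {suc z} {suc z'} (cong₂ _,_ a≡a' (negate-injective r≡r'))

  pageMark-first : ∀ i → pageMark i ≢ mark zero zero
  pageMark-first (suc z) same with mark-injective same
  ... | r≡0 , a≡0 = contradiction (code-injective {suc z} {zero} (cong₂ _,_ a≡0 (negate≡zero r≡0))) λ ()

  canonical : Coloring (4 + k) (2 + n) (2 + q)
  canonical = sparseColouring zero pageMark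

  canonical-distinguishing : Distinguishing (4 + k) (2 + n) canonical
  canonical-distinguishing = sparseColouring-distinguishing zero pageMark pageMark-injective zero (suc zero) refl pageMark-first

  canonical-outsideClass : outsideClass (4 + k) (2 + n) canonical zero ≡ suc n
  canonical-outsideClass = trans (outsideClass-sparseColouring zero pageMark) (sum-const-1 (suc n))

  canonical-determining : Determining (4 + k) (2 + n) (outside canonical zero)
  canonical-determining = distinguishing⇒outside-determining canonical zero canonical-distinguishing

  size-canonical-determining : size (4 + k) (2 + n) (outside canonical zero) ≡ suc n
  size-canonical-determining = trans (size-outside canonical zero) canonical-outsideClass

mainTheorem11 : (m n : ℕ) → 2 ≤ n → (m≥4 : 4 ≤ m) →
    DistF m n (2 + ((n ∸ 1) / (m ∸ 2)) {{m∸2-nonZero m≥4}})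
mainTheorem11 (suc (suc (suc (suc k)))) (suc (suc n)) (s≤s (s≤s _)) (s≤s (s≤s (s≤s (s≤s _)))) =
  (suc n , paint-cost , det) , fewer-colours
  where
  open Canonical k n
  det : Det (4 + k) (2 + n) (suc n)
  det = (outside canonical zero , canonical-determining , size-canonical-determining)
      , λ S S-det → s≤s⁻¹ (determining-size-bound S S-det)
  paint-cost : PaintCost (4 + k) (2 + n) (2 + q) (suc n)
  paint-cost = (canonical , canonical-distinguishing , zero , canonical-outsideClass)
             , λ c dist t → s≤s⁻¹ (outsideClass-bound c dist t)
  fewer-colours : ∀ d → d < 2 + q → ¬ RhoEqDet (4 + k) (2 + n) d
  fewer-colours zero    _     (_ , ((_ , _ , () , _) , _) , _)
  fewer-colours (suc d) d<2+q (r , ((c , dist , t , outside≡r) , _) , (_ , r-min)) =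
    <⇒≱ few-codes (tight-distinguishing⇒pages≤ c t dist (cong suc tight))
    where
    tight : outsideClass (4 + k) (2 + n) c t ≡ suc n
    tight = ≤-antisym (subst₂ _≤_ (sym outside≡r) size-canonical-determining (r-min _ canonical-determining))
                      (s≤s⁻¹ (outsideClass-bound c dist t))
    few-codes : (2 + k) * d < 2 + n
    few-codes = s≤s (begin
      (2 + k) * d   ≤⟨ *-monoʳ-≤ (2 + k) (s≤s⁻¹ (s≤s⁻¹ d<2+q)) ⟩
      (2 + k) * q   ≡⟨ *-comm (2 + k) q ⟩
      q * (2 + k)   ≤⟨ q*[2+k]≤1+n ⟩
      suc n         ∎)
      where open ≤-Reasoning
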